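{- Fix positive integers $r,s$ and let $f=f_{r,s}$ be the one-dimensional generalized rotor-router map on $\Sigma$ described in the context. The set $\mathbf{Rec}$ is closed under $f$, i.e. $f(\mathbf{Rec})\subseteq\mathbf{Rec}$. Moreover, for every state $\sigma\in\Sigma$ there is an integer $N\ge 0$ with $f^N(\sigma)\in\mathbf{Rec}$.
   Context: For integers $a\le b$, $[a,b]=\{k\in\mathbb{Z}: a\le k\le b\}$ (empty if $a>b$). Fix positive integers $r,s$. A state consists of integers $x\le 0\le y$ (occupied interval $[x,y]$) and a labeling $[x,y]\to\{L,R\}$; $\Sigma(x,y)$ is the set of such states and $\Sigma=\bigcup_{x\le0\le y}\Sigma(x,y)$. The map $f=f_{r,s}$: a particle starts at $0$; at an occupied site $k$ it moves to $k-1$ if the label at $k$ is $L$ and to $k+1$ if it is $R$, and the label at $k$ is then switched; when it first reaches an unoccupied site, if this is $x-1$ the sites $[x-r,x-1]$ become occupied with label $R$, and if it is $y+1$ the sites $[y+1,y+s]$ become occupied with label $R$; the result is $f(\sigma)$. For integers $x\le 0\le y$, $\mathbf{Rec}(x,y)\subset\Sigma(x,y+s-1)$ is the set of states for which there is an integer $0\le i\le y-x+1$ such that $[x,x+i-1]$ is entirely labeled $R$, $[x+i,y-1]$ is entirely labeled $L$, and $[y,y+s-1]$ is entirely labeled $R$ (shorthand: the state has the form $R^iL^jR^s$). $\mathbf{Rec}=\bigcup_{x\le 0\le y}\mathbf{Rec}(x,y)$. -}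

module Defs where

open import Data.Nat as ℕ using (ℕ; zero; suc)
open import Data.Integer using (ℤ; +_; _+_; _-_; _≤_; _<_; _≤?_; _<?_; _≟_)
open import Data.Bool using (if_then_else_)
open import Data.Product using (Σ; _×_; ∃)
open import Relation.Nullary.Decidable using (⌊_⌋)
open import Relation.Binary.PropositionalEquality using (_≡_)

data Label : Set where
  L R : Label

switch : Label → Label
switch L = R
switch R = L

-- The labeling is
-- given as a function ℤ → Label; only its values on [x , y] are meaningful
-- (all predicates/maps below only read labels on the occupied interval).
record State : Set where
  constructor mkState
  field
    x   : ℤ
    y   : ℤ
    lab : ℤ → Label
open State public

InΣ : State → Set
InΣ σ = (x σ ≤ + 0) × (+ 0 ≤ y σ)

flipAt : State → ℤ → State
flipAt σ k = mkState (x σ) (y σ)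
  (λ j → if ⌊ j ≟ k ⌋ then switch (lab σ k) else lab σ j)

extendLeft : ℕ → State → State
extendLeft r σ = mkState (x σ - + r) (y σ)
  (λ j → if ⌊ j <? x σ ⌋ then R else lab σ j)

extendRight : ℕ → State → State
extendRight s σ = mkState (x σ) (y σ + + s)
  (λ j → if ⌊ y σ <? j ⌋ then R else lab σ j)

data Walk (r s : ℕ) : State → ℤ → State → Set where
  exitLeft  : ∀ {σ k} → k ≡ x σ - + 1 → Walk r s σ k (extendLeft r σ)
  exitRight : ∀ {σ k} → k ≡ y σ + + 1 → Walk r s σ k (extendRight s σ)
  stepL : ∀ {σ k τ} → x σ ≤ k → k ≤ y σ → lab σ k ≡ L →
          Walk r s (flipAt σ k) (k - + 1) τ → Walk r s σ k τ
  stepR : ∀ {σ k τ} → x σ ≤ k → k ≤ y σ → lab σ k ≡ R →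
          Walk r s (flipAt σ k) (k + + 1) τ → Walk r s σ k τ

-- The graph of f = f_{r,s}:  F r s σ τ  iff  f(σ) = τ  (particle starts at 0).
F : ℕ → ℕ → State → State → Set
F r s σ τ = Walk r s σ (+ 0) τ

data FIter (r s : ℕ) : ℕ → State → State → Set where
  iter0 : ∀ {σ} → FIter r s zero σ σ
  iterS : ∀ {n σ τ υ} → F r s σ τ → FIter r s n τ υ → FIter r s (suc n) σ υ

-- Rec(x , y₀) ⊆ Σ(x , y₀ + s - 1): states of the form R^i L^j R^s.
RecAt : ℕ → ℤ → State → Set
RecAt s y₀ σ =
  (x σ ≤ + 0) × (+ 0 ≤ y₀) × (y σ ≡ y₀ + + s - + 1) ×
  Σ ℕ (λ i →
    (+ i ≤ y₀ - x σ + + 1) ×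
    (∀ k → x σ ≤ k → k ≤ x σ + + i - + 1 → lab σ k ≡ R) ×
    (∀ k → x σ + + i ≤ k → k ≤ y₀ - + 1 → lab σ k ≡ L) ×
    (∀ k → y₀ ≤ k → k ≤ y₀ + + s - + 1 → lab σ k ≡ R))

Rec : ℕ → State → Set
Rec s σ = ∃ λ y₀ → RecAt s y₀ σ

-- A walk of the particle is described without knowing how long it lasts: if it
-- leaves through the left end, the farthest site z it reached to the right was
-- originally labelled L (it turned back there), every visited site is now labelled R
-- and the sites beyond z are untouched; symmetrically for the right end.  That walks
-- terminate at all follows by induction on the length of the occupied interval.
-- For a state R^i L^j R^s this description shows at once that f produces a state of
-- the same form.  Starting from any state of Σ, one application of f gives either a
-- state labelled R on [x , e] with 0 ≤ e, or one labelled L on [b , y - s] followed by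
-- the freshly appended R^s with b ≤ 0.  Every further application either produces a
-- state of Rec or moves e strictly right (resp. b strictly left), which can happen
-- only finitely often.
module Submission where

open import Defs
open import Data.Nat as ℕ using (ℕ; zero; suc)
open import Data.Integer using (ℤ; +_; -_; +≤+; -1ℤ; _+_; _-_; _≤_; _<_; _≤?_; _<?_; _≟_; ∣_∣)
open import Data.Integer.Properties
open import Data.Integer.Tactic.RingSolver using (solve-∀)
open import Data.Bool using (if_then_else_)
open import Data.Product using (_×_; ∃; ∃₂; _,_; proj₁; proj₂)
open import Data.Sum using (_⊎_; inj₁; inj₂)
import Data.Sum as Sum
open import Relation.Nullary using (yes; no; contradiction)
open import Relation.Nullary.Decidable using (⌊_⌋)
open import Relation.Binary.PropositionalEquality
  using (_≡_; _≢_; refl; sym; trans; cong; subst; subst₂; ≢-sym)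

+1≤⇒< : ∀ {i j} → i + + 1 ≤ j → i < j
+1≤⇒< {i} {j} p = suc[i]≤j⇒i<j (subst (_≤ j) (+-comm i (+ 1)) p)

<⇒+1≤ : ∀ {i j} → i < j → i + + 1 ≤ j
<⇒+1≤ {i} {j} p = subst (_≤ j) (+-comm (+ 1) i) (i<j⇒suc[i]≤j p)

≤-1⇒< : ∀ {i j} → i ≤ j - + 1 → i < j
≤-1⇒< {i} {j} p = i≤pred[j]⇒i<j (subst (i ≤_) (+-comm j -1ℤ) p)

<⇒≤-1 : ∀ {i j} → i < j → i ≤ j - + 1
<⇒≤-1 {i} {j} p = subst (i ≤_) (+-comm -1ℤ j) (i<j⇒i≤pred[j] p)

i<i+1 : ∀ i → i < i + + 1
i<i+1 i = +1≤⇒< ≤-refl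

i-1<i : ∀ i → i - + 1 < i
i-1<i i = ≤-1⇒< ≤-refl

+1-1 : ∀ i → i + + 1 - + 1 ≡ i
+1-1 = solve-∀

-1+1 : ∀ i → i - + 1 + + 1 ≡ i
-1+1 = solve-∀

-1<⇒≤ : ∀ {i j} → i - + 1 < j → i ≤ j
-1<⇒≤ {i} {j} p = subst (_≤ j) (-1+1 i) (<⇒+1≤ p)

<+1⇒≤ : ∀ {i j} → i < j + + 1 → i ≤ j
<+1⇒≤ {i} {j} p = subst (i ≤_) (+1-1 j) (<⇒≤-1 p)

<+suc⇒≤ : ∀ {i j} m → i < j + + suc m → i ≤ j + + m
<+suc⇒≤ {i} {j} m p = <+1⇒≤ (subst (i <_) (reassoc j (+ m)) p)
  where
  reassoc : ∀ j M → j + (+ 1 + M) ≡ j + M + + 1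
  reassoc = solve-∀

i+j≡i+1+j-1 : ∀ i j → i + j ≡ i + + 1 + j - + 1
i+j≡i+1+j-1 = solve-∀

+∣-∣-cancel : ∀ {i j} → i ≤ j → i + + ∣ j - i ∣ ≡ j
+∣-∣-cancel {i} {j} i≤j = trans (cong (_+_ i) (0≤i⇒+∣i∣≡i (i≤j⇒0≤j-i i≤j))) (i+[j-i]≡j i j)
  where
  i+[j-i]≡j : ∀ i j → i + (j - i) ≡ j
  i+[j-i]≡j = solve-∀

R≢L : R ≢ L
R≢L ()

_≐_on[_,_] : (ℤ → Label) → Label → ℤ → ℤ → Set
g ≐ c on[ a , b ] = ∀ j → a ≤ j → j ≤ b → g j ≡ c

≐-weaken : ∀ {g c a b a′ b′} → a ≤ a′ → b′ ≤ b → g ≐ c on[ a , b ] → g ≐ c on[ a′ , b′ ]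
≐-weaken a≤a′ b′≤b g≐c j a′≤j j≤b′ = g≐c j (≤-trans a≤a′ a′≤j) (≤-trans j≤b′ b′≤b)

≐-cons : ∀ {g c a b} → g a ≡ c → g ≐ c on[ a + + 1 , b ] → g ≐ c on[ a , b ]
≐-cons {a = a} ga g≐c j a≤j j≤b with j ≟ a
... | yes refl = ga
... | no j≢a = g≐c j (<⇒+1≤ (≤∧≢⇒< a≤j (≢-sym j≢a))) j≤b

≐-snoc : ∀ {g c a b} → g ≐ c on[ a , b - + 1 ] → g b ≡ c → g ≐ c on[ a , b ]
≐-snoc {b = b} g≐c gb j a≤j j≤b with j ≟ b
... | yes refl = gb
... | no j≢b = g≐c j a≤j (<⇒≤-1 (≤∧≢⇒< j≤b j≢b))

Occupied : State → ℤ → Set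
Occupied σ k = x σ ≤ k × k ≤ y σ

-- lab (flipAt σ k) is definitionally switchAt (lab σ) k.
switchAt : (ℤ → Label) → ℤ → ℤ → Label
switchAt g k j = if ⌊ j ≟ k ⌋ then switch (g k) else g j

switchAt-same : ∀ g k → switchAt g k k ≡ switch (g k)
switchAt-same g k with k ≟ k
... | yes _ = refl
... | no k≢k = contradiction refl k≢k

switch-≢ : ∀ c → switch c ≢ c
switch-≢ L ()
switch-≢ R ()

switchAt-reflects : ∀ g {k j c} → g k ≡ c → switchAt g k j ≡ c → g j ≡ c
switchAt-reflects g {k} {j} gk≡c g′j≡c with j ≟ k
... | yes refl = contradiction (trans (sym (cong switch gk≡c)) g′j≡c) (switch-≢ _)
... | no _ = g′j≡c

switchAt-other : ∀ g {k j} → j ≢ k → switchAt g k j ≡ g j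
switchAt-other g {k} {j} j≢k with j ≟ k
... | yes j≡k = contradiction j≡k j≢k
... | no _ = refl

extendLeft-new : ∀ r σ {j} → j < x σ → lab (extendLeft r σ) j ≡ R
extendLeft-new r σ {j} j<x with j <? x σ
... | yes _ = refl
... | no j≮x = contradiction j<x j≮x

extendLeft-old : ∀ r σ {j} → x σ ≤ j → lab (extendLeft r σ) j ≡ lab σ j
extendLeft-old r σ {j} x≤j with j <? x σ
... | yes j<x = contradiction x≤j (<⇒≱ j<x)
... | no _ = refl

extendRight-new : ∀ s σ {j} → y σ < j → lab (extendRight s σ) j ≡ R
extendRight-new s σ {j} y<j with y σ <? j
... | yes _ = refl
... | no y≮j = contradiction y<j y≮j

extendRight-old : ∀ s σ {j} → j ≤ y σ → lab (extendRight s σ) j ≡ lab σ j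
extendRight-old s σ {j} j≤y with y σ <? j
... | yes y<j = contradiction j≤y (<⇒≱ y<j)
... | no _ = refl

data Run (X Y : ℤ) : (ℤ → Label) → ℤ → (ℤ → Label) → ℤ → Set where
  stay  : ∀ {g k} → Run X Y g k g k
  moveL : ∀ {g k g′ k′} → X ≤ k → k ≤ Y → g k ≡ L →
          Run X Y (switchAt g k) (k - + 1) g′ k′ → Run X Y g k g′ k′
  moveR : ∀ {g k g′ k′} → X ≤ k → k ≤ Y → g k ≡ R →
          Run X Y (switchAt g k) (k + + 1) g′ k′ → Run X Y g k g′ k′

module _ {X Y : ℤ} where

  _▻▻_ : ∀ {g p g′ k g″ k′} → Run X Y g p g′ k → Run X Y g′ k g″ k′ → Run X Y g p g″ k′
  stay                 ▻▻ run′ = run′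
  moveL X≤k k≤Y gk run ▻▻ run′ = moveL X≤k k≤Y gk (run ▻▻ run′)
  moveR X≤k k≤Y gk run ▻▻ run′ = moveR X≤k k≤Y gk (run ▻▻ run′)

  run-widenˡ : ∀ {X′ g p g′ k} → X′ ≤ X → Run X Y g p g′ k → Run X′ Y g p g′ k
  run-widenˡ X′≤X stay                 = stay
  run-widenˡ X′≤X (moveL X≤k k≤Y gk run) =
    moveL (≤-trans X′≤X X≤k) k≤Y gk (run-widenˡ X′≤X run)
  run-widenˡ X′≤X (moveR X≤k k≤Y gk run) =
    moveR (≤-trans X′≤X X≤k) k≤Y gk (run-widenˡ X′≤X run)

  run-frameˡ : ∀ {g p g′ k j} → Run X Y g p g′ k → j < X → g′ j ≡ g j
  run-frameˡ stay j<X = refl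
  run-frameˡ {g} (moveL X≤k _ _ run) j<X =
    trans (run-frameˡ run j<X) (switchAt-other g (<⇒≢ (<-≤-trans j<X X≤k)))
  run-frameˡ {g} (moveR X≤k _ _ run) j<X =
    trans (run-frameˡ run j<X) (switchAt-other g (<⇒≢ (<-≤-trans j<X X≤k)))

  run-walk : ∀ {r s g p g′ k τ} → Run X Y g p g′ k →
             Walk r s (mkState X Y g′) k τ → Walk r s (mkState X Y g) p τ
  run-walk stay                 w = w
  run-walk (moveL X≤k k≤Y gk run) w = stepL X≤k k≤Y gk (run-walk run w)
  run-walk (moveR X≤k k≤Y gk run) w = stepR X≤k k≤Y gk (run-walk run w)

Exit : ℤ → ℤ → ℤ → Set
Exit X Y k = k ≡ X - + 1 ⊎ k ≡ Y + + 1

Escapes : ℤ → ℤ → (ℤ → Label) → ℤ → Set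
Escapes X Y g p = ∃₂ λ g′ k → Run X Y g p g′ k × Exit X Y k

-- Induction on the length of [X , Y]: the particle first escapes from [X + 1 , Y];
-- if it does so through X it is sent back into [X + 1 , Y] at most once more,
-- because the label at X points left after the first visit.
run-escapes : ∀ n {X Y} → Y < X + + n → ∀ g {p} → X - + 1 ≤ p → p ≤ Y + + 1 → Escapes X Y g p
run-escapes n {X} {Y} _ g {p} lo hi with X ≤? p | p ≤? Y
... | no X≰p | _ =
  g , p , stay , inj₁ (≤-antisym (<⇒≤-1 (≰⇒> X≰p)) lo)
... | yes _ | no p≰Y =
  g , p , stay , inj₂ (≤-antisym hi (<⇒+1≤ (≰⇒> p≰Y)))
run-escapes zero {X} {Y} Y<X g lo hi | yes X≤p | yes p≤Y =
  contradiction (≤-trans X≤p p≤Y) (<⇒≱ (subst (Y <_) (+-identityʳ X) Y<X))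
run-escapes (suc m) {X} {Y} Y<X+n g {p} lo hi | yes X≤p | yes p≤Y =
  via-inner (run-escapes m Y<X+1+m g (subst (_≤ p) (sym (+1-1 X)) X≤p) hi)
  where
  X≤X+1 : X ≤ X + + 1
  X≤X+1 = <⇒≤ (i<i+1 X)

  Y<X+1+m : Y < X + + 1 + + m
  Y<X+1+m = subst (Y <_) (sym (+-assoc X (+ 1) (+ m))) Y<X+n

  X≤Y : X ≤ Y
  X≤Y = ≤-trans X≤p p≤Y

  ending-at-X : ∀ {h q h′ k} → Run (X + + 1) Y h q h′ k → k ≡ X + + 1 - + 1 → Run (X + + 1) Y h q h′ X
  ending-at-X run k≡X = subst (Run _ Y _ _ _) (trans k≡X (+1-1 X)) run

  from-left-end : ∀ h → Escapes X Y h X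
  from-left-end h with h X in hX
  ... | L = switchAt h X , X - + 1 , moveL ≤-refl X≤Y hX stay , inj₁ refl
  ... | R with run-escapes m Y<X+1+m (switchAt h X) {X + + 1}
                 (<⇒≤ (i-1<i (X + + 1))) (+-monoˡ-≤ (+ 1) X≤Y)
  ...   | h′ , k , run , inj₂ k≡Y+1 =
    h′ , k , moveR ≤-refl X≤Y hX (run-widenˡ X≤X+1 run) , inj₂ k≡Y+1
  ...   | h′ , k , run , inj₁ k≡X =
    switchAt h′ X , X - + 1 ,
    moveR ≤-refl X≤Y hX (run-widenˡ X≤X+1 (ending-at-X run k≡X) ▻▻ moveL ≤-refl X≤Y h′X≡L stay) ,
    inj₁ refl
    where
    h′X≡L : h′ X ≡ L
    h′X≡L = trans (run-frameˡ (ending-at-X run k≡X) (i<i+1 X)) (trans (switchAt-same h X) (cong switch hX))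

  via-inner : Escapes (X + + 1) Y g p → Escapes X Y g p
  via-inner (g₁ , k , run , inj₂ k≡Y+1) = g₁ , k , run-widenˡ X≤X+1 run , inj₂ k≡Y+1
  via-inner (g₁ , k , run , inj₁ k≡X) with from-left-end g₁
  ... | g₂ , k′ , run′ , exit = g₂ , k′ , run-widenˡ X≤X+1 (ending-at-X run k≡X) ▻▻ run′ , exit

long-enough : ∀ {X Y} → X ≤ Y → Y < X + + suc ∣ Y - X ∣
long-enough {X} {Y} X≤Y = subst (Y <_) Y+1≡ (i<i+1 Y)
  where
  Y+1≡ : Y + + 1 ≡ X + + suc ∣ Y - X ∣
  Y+1≡ = trans (cong (_+ + 1) (sym (+∣-∣-cancel X≤Y)))
               (trans (+-assoc X _ (+ 1)) (cong (_+_ X) (+-comm (+ ∣ Y - X ∣) (+ 1))))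

module _ (r s : ℕ) where

  walk-exists : ∀ σ {p} → x σ ≤ p → p ≤ y σ → ∃ (Walk r s σ p)
  walk-exists σ x≤p p≤y
    with run-escapes _ (long-enough (≤-trans x≤p p≤y)) (lab σ)
           (≤-trans (<⇒≤ (i-1<i (x σ))) x≤p) (≤-trans p≤y (<⇒≤ (i<i+1 (y σ))))
  ... | _ , _ , run , inj₁ k≡x-1 = _ , run-walk run (exitLeft k≡x-1)
  ... | _ , _ , run , inj₂ k≡y+1 = _ , run-walk run (exitRight k≡y+1)

  -- rightmost is the farthest site reached; the particle turned back there, so it was
  -- labelled L, unless it is the exit site itself.  Visited sites end up pointing to the exit.
  record LeftExit (σ : State) (p : ℤ) (τ : State) : Set where
    constructor leftExit
    field
      x-decreases      : x τ ≤ x σ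
      y-unchanged      : y τ ≡ y σ
      rightmost        : ℤ
      start≤rightmost  : p ≤ rightmost
      rightmost-was-L  : (Occupied σ rightmost × lab σ rightmost ≡ L) ⊎ rightmost ≡ x σ - + 1
      swept            : lab τ ≐ R on[ x τ , rightmost ]
      unvisited        : ∀ j → rightmost < j → lab τ j ≡ lab σ j

  record RightExit (σ : State) (p : ℤ) (τ : State) : Set where
    constructor rightExit
    field
      x-unchanged      : x τ ≡ x σ
      y-increases      : y τ ≡ y σ + + s
      leftmost         : ℤ
      leftmost≤start   : leftmost ≤ p
      leftmost-was-R   : (Occupied σ leftmost × lab σ leftmost ≡ R) ⊎ leftmost ≡ y σ + + 1
      swept            : lab τ ≐ L on[ leftmost , y σ ]
      appended         : lab τ ≐ R on[ y σ + + 1 , y σ + + s ]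
      unvisited        : ∀ j → j < leftmost → lab τ j ≡ lab σ j

  left-exit-now : ∀ σ → LeftExit σ (x σ - + 1) (extendLeft r σ)
  left-exit-now σ = leftExit (i-j≤i (x σ) (+ r)) refl (x σ - + 1) ≤-refl (inj₂ refl)
    (λ j _ j≤x-1 → extendLeft-new r σ (≤-1⇒< j≤x-1))
    (λ j x-1<j → extendLeft-old r σ (-1<⇒≤ x-1<j))

  right-exit-now : ∀ σ → RightExit σ (y σ + + 1) (extendRight s σ)
  right-exit-now σ = rightExit refl refl (y σ + + 1) ≤-refl (inj₂ refl)
    (λ j y+1≤j j≤y → contradiction (≤-trans y+1≤j j≤y) (<⇒≱ (i<i+1 (y σ))))
    (λ j y+1≤j _ → extendRight-new s σ (+1≤⇒< y+1≤j))
    (λ j j<y+1 → extendRight-old s σ (<+1⇒≤ j<y+1))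

  left-after-L : ∀ {σ k τ} → Occupied σ k → lab σ k ≡ L →
                 LeftExit (flipAt σ k) (k - + 1) τ → LeftExit σ k τ
  left-after-L {σ} {k} occ lk (leftExit x≤ y≡ z k-1≤z was-L swept unvisited) with k ≤? z
  ... | yes k≤z =
    leftExit x≤ y≡ z k≤z (Sum.map₁ (λ (o , lz) → o , switchAt-reflects (lab σ) lk lz) was-L) swept
      (λ j z<j → trans (unvisited j z<j) (switchAt-other (lab σ) (≢-sym (<⇒≢ (≤-<-trans k≤z z<j)))))
  ... | no k≰z =
    leftExit x≤ y≡ k ≤-refl (inj₁ (occ , lk))
      (≐-snoc (≐-weaken ≤-refl k-1≤z swept)
              (trans (unvisited k (≰⇒> k≰z)) (trans (switchAt-same (lab σ) k) (cong switch lk))))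
      (λ j k<j → trans (unvisited j (<-trans (≰⇒> k≰z) k<j))
                       (switchAt-other (lab σ) (≢-sym (<⇒≢ k<j))))

  right-after-L : ∀ {σ k τ} → lab σ k ≡ L →
                  RightExit (flipAt σ k) (k - + 1) τ → RightExit σ k τ
  right-after-L {σ} {k} lk (rightExit x≡ y≡ z z≤k-1 was-R swept appended unvisited) =
    rightExit x≡ y≡ z (≤-trans z≤k-1 (<⇒≤ (i-1<i k)))
      (Sum.map₁ (λ (o , rz) → o , trans (sym (switchAt-other (lab σ) (<⇒≢ z<k))) rz) was-R)
      swept appended
      (λ j j<z → trans (unvisited j j<z) (switchAt-other (lab σ) (<⇒≢ (<-trans j<z z<k))))
    where
    z<k : z < k
    z<k = ≤-1⇒< z≤k-1

  left-after-R : ∀ {σ k τ} → lab σ k ≡ R →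
                 LeftExit (flipAt σ k) (k + + 1) τ → LeftExit σ k τ
  left-after-R {σ} {k} rk (leftExit x≤ y≡ z k+1≤z was-L swept unvisited) =
    leftExit x≤ y≡ z (<⇒≤ k<z)
      (Sum.map₁ (λ (o , lz) → o , trans (sym (switchAt-other (lab σ) (≢-sym (<⇒≢ k<z)))) lz) was-L)
      swept
      (λ j z<j → trans (unvisited j z<j) (switchAt-other (lab σ) (≢-sym (<⇒≢ (<-trans k<z z<j)))))
    where
    k<z : k < z
    k<z = +1≤⇒< k+1≤z

  right-after-R : ∀ {σ k τ} → Occupied σ k → lab σ k ≡ R →
                  RightExit (flipAt σ k) (k + + 1) τ → RightExit σ k τ
  right-after-R {σ} {k} occ rk (rightExit x≡ y≡ z z≤k+1 was-R swept appended unvisited) with z ≤? k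
  ... | yes z≤k =
    rightExit x≡ y≡ z z≤k (Sum.map₁ (λ (o , rz) → o , switchAt-reflects (lab σ) rk rz) was-R)
      swept appended
      (λ j j<z → trans (unvisited j j<z) (switchAt-other (lab σ) (<⇒≢ (<-≤-trans j<z z≤k))))
  ... | no z≰k =
    rightExit x≡ y≡ k ≤-refl (inj₁ (occ , rk))
      (≐-cons (trans (unvisited k (≰⇒> z≰k)) (trans (switchAt-same (lab σ) k) (cong switch rk)))
              (≐-weaken z≤k+1 ≤-refl swept))
      appended
      (λ j j<k → trans (unvisited j (<-trans j<k (≰⇒> z≰k))) (switchAt-other (lab σ) (<⇒≢ j<k)))

  walk-outcome : ∀ {σ p τ} → Walk r s σ p τ → LeftExit σ p τ ⊎ RightExit σ p τ
  walk-outcome (exitLeft {σ} refl)  = inj₁ (left-exit-now σ)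
  walk-outcome (exitRight {σ} refl) = inj₂ (right-exit-now σ)
  walk-outcome (stepL x≤k k≤y lk w) =
    Sum.map (left-after-L (x≤k , k≤y) lk) (right-after-L lk) (walk-outcome w)
  walk-outcome (stepR x≤k k≤y rk w) =
    Sum.map (left-after-R rk) (right-after-R (x≤k , k≤y) rk) (walk-outcome w)

  -- Rec(x , y₀) with the boundary a = x + i between the R- and L-blocks in place of i.
  record Staircase (τ : State) (a y₀ : ℤ) : Set where
    constructor staircase
    field
      x≤0      : x τ ≤ + 0
      0≤y₀     : + 0 ≤ y₀
      y≡       : y τ ≡ y₀ + + s - + 1
      x≤a      : x τ ≤ a
      a≤y₀+1   : a ≤ y₀ + + 1
      R-block  : ∀ j → x τ ≤ j → j < a → lab τ j ≡ R
      L-block  : ∀ j → a ≤ j → j < y₀ → lab τ j ≡ L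
      top      : lab τ ≐ R on[ y₀ , y τ ]

  staircase⇒Rec : ∀ {τ a y₀} → Staircase τ a y₀ → Rec s τ
  staircase⇒Rec {τ} {a} {y₀} (staircase x≤0 0≤y₀ y≡ x≤a a≤y₀+1 R-block L-block top) =
    y₀ , x≤0 , 0≤y₀ , y≡ , ∣ a - x τ ∣ , i≤ ,
    (λ k x≤k k≤ → R-block k x≤k (≤-1⇒< (subst (λ u → k ≤ u - + 1) x+i≡a k≤))) ,
    (λ k x+i≤k k≤ → L-block k (subst (_≤ k) x+i≡a x+i≤k) (≤-1⇒< k≤)) ,
    (λ k y₀≤k k≤ → top k y₀≤k (subst (k ≤_) (sym y≡) k≤))
    where
    x+i≡a : x τ + + ∣ a - x τ ∣ ≡ a
    x+i≡a = +∣-∣-cancel x≤a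

    shift : ∀ X Y → Y + + 1 - X ≡ Y - X + + 1
    shift = solve-∀

    i≤ : + ∣ a - x τ ∣ ≤ y₀ - x τ + + 1
    i≤ = subst₂ _≤_ (sym (0≤i⇒+∣i∣≡i (i≤j⇒0≤j-i x≤a))) (shift (x τ) y₀) (+-monoˡ-≤ _ a≤y₀+1)

  staircase-0≤y : 1 ℕ.≤ s → ∀ {τ a y₀} → Staircase τ a y₀ → + 0 ≤ y τ
  staircase-0≤y 1≤s {τ} {a} {y₀} st =
    ≤-trans (Staircase.0≤y₀ st)
      (subst₂ _≤_ (+1-1 y₀) (sym (Staircase.y≡ st)) (+-monoˡ-≤ (- + 1) (+-monoʳ-≤ y₀ (+≤+ 1≤s))))

  Rec⇒staircase : ∀ {τ} → Rec s τ → ∃₂ (Staircase τ)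
  Rec⇒staircase {τ} (y₀ , x≤0 , 0≤y₀ , y≡ , i , i≤ , R-block , L-block , top) =
    x τ + + i , y₀ ,
    staircase x≤0 0≤y₀ y≡ (i≤i+j (x τ) (+ i))
      (subst (x τ + + i ≤_) (cancel (x τ) y₀) (+-monoʳ-≤ (x τ) i≤))
      (λ j x≤j j<a → R-block j x≤j (<⇒≤-1 j<a))
      (λ j a≤j j<y₀ → L-block j a≤j (<⇒≤-1 j<y₀))
      (λ j y₀≤j j≤y → top j y₀≤j (subst (j ≤_) y≡ j≤y))
    where
    cancel : ∀ X Y → X + (Y - X + + 1) ≡ Y + + 1
    cancel = solve-∀

  rightmost-turned : ∀ {σ p τ} → x σ ≤ p → (o : LeftExit σ p τ) →
                     Occupied σ (LeftExit.rightmost o) × lab σ (LeftExit.rightmost o) ≡ L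
  rightmost-turned x≤p o with LeftExit.rightmost-was-L o
  ... | inj₁ turned = turned
  ... | inj₂ z≡x-1 =
    contradiction (≤-trans x≤p (LeftExit.start≤rightmost o)) (<⇒≱ (subst (_< _) (sym z≡x-1) (i-1<i _)))

  leftmost-turned : ∀ {σ p τ} → p ≤ y σ → (o : RightExit σ p τ) →
                    Occupied σ (RightExit.leftmost o) × lab σ (RightExit.leftmost o) ≡ R
  leftmost-turned p≤y o with RightExit.leftmost-was-R o
  ... | inj₁ turned = turned
  ... | inj₂ z≡y+1 =
    contradiction (≤-trans (RightExit.leftmost≤start o) p≤y) (<⇒≱ (subst (_ <_) (sym z≡y+1) (i<i+1 _)))

  left-exit-staircase : ∀ {σ τ y₀} → x σ ≤ + 0 → + 0 ≤ y₀ → y σ ≡ y₀ + + s - + 1 →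
    (o : LeftExit σ (+ 0) τ) → let z = LeftExit.rightmost o in z < y₀ →
    (∀ j → z < j → j < y₀ → lab σ j ≡ L) → lab σ ≐ R on[ y₀ , y σ ] →
    Staircase τ (z + + 1) y₀
  left-exit-staircase {τ = τ} x≤0 0≤y₀ y≡ (leftExit x≤ y-same z 0≤z _ swept unvisited)
                      z<y₀ L-above top =
    staircase x′≤0 0≤y₀ (trans y-same y≡) (≤-trans x′≤0 (≤-trans 0≤z (<⇒≤ (i<i+1 z))))
      (≤-trans (<⇒+1≤ z<y₀) (<⇒≤ (i<i+1 _)))
      (λ j x≤j j<z+1 → swept j x≤j (<+1⇒≤ j<z+1))
      (λ j z+1≤j j<y₀ → trans (unvisited j (+1≤⇒< z+1≤j)) (L-above j (+1≤⇒< z+1≤j) j<y₀))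
      (λ j y₀≤j j≤y → trans (unvisited j (<-≤-trans z<y₀ y₀≤j))
                            (top j y₀≤j (subst (j ≤_) y-same j≤y)))
    where
    x′≤0 : x τ ≤ + 0
    x′≤0 = ≤-trans x≤ x≤0

  right-exit-staircase : ∀ {σ τ a} → x σ ≤ + 0 → + 0 ≤ y σ →
    (o : RightExit σ (+ 0) τ) → let z = RightExit.leftmost o in x σ ≤ a → a ≤ z →
    (∀ j → x σ ≤ j → j < a → lab σ j ≡ R) → (∀ j → a ≤ j → j < z → lab σ j ≡ L) →
    Staircase τ a (y σ + + 1)
  right-exit-staircase {σ} {τ} {a} x≤0 0≤y (rightExit x-same y≡ z z≤0 _ swept appended unvisited)
                       x≤a a≤z R-below L-below =
    staircase (subst (_≤ + 0) (sym x-same) x≤0) (≤-trans 0≤y (<⇒≤ (i<i+1 _)))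
      (trans y≡ (i+j≡i+1+j-1 (y σ) (+ s)))
      (subst (_≤ _) (sym x-same) x≤a)
      (≤-trans a≤z (≤-trans z≤0 (≤-trans 0≤y (≤-trans (<⇒≤ (i<i+1 _)) (<⇒≤ (i<i+1 _))))))
      (λ j x≤j j<a → trans (unvisited j (<-≤-trans j<a a≤z)) (R-below j (subst (_≤ j) x-same x≤j) j<a))
      L-block
      (λ j y+1≤j j≤y′ → appended j y+1≤j (subst (j ≤_) y≡ j≤y′))
    where
    L-block : ∀ j → a ≤ j → j < y σ + + 1 → lab τ j ≡ L
    L-block j a≤j j<y+1 with j <? z
    ... | yes j<z = trans (unvisited j j<z) (L-below j a≤j j<z)
    ... | no j≮z = swept j (≮⇒≥ j≮z) (<+1⇒≤ j<y+1)

  Reaches : State → Set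
  Reaches σ = ∃ λ N → ∃ λ τ → FIter r s N σ τ × Rec s τ

  reaches-now : ∀ {σ} → Rec s σ → Reaches σ
  reaches-now rec = 0 , _ , iter0 , rec

  reaches-later : ∀ {σ τ} → F r s σ τ → Reaches τ → Reaches σ
  reaches-later w (N , υ , iter , rec) = suc N , υ , iterS w iter , rec

  reaches-from-R-prefix : ∀ n {σ e} → x σ ≤ + 0 → + 0 ≤ e → e ≤ y σ →
    lab σ ≐ R on[ x σ , e ] → y σ ≤ e + + n → Reaches σ
  reaches-from-R-prefix n {σ} {e} x≤0 0≤e e≤y R-prefix y≤e+n = after-f (walk-exists σ x≤0 0≤y)
    where
    0≤y : + 0 ≤ y σ
    0≤y = ≤-trans 0≤e e≤y

    after-f : ∃ (F r s σ) → Reaches σ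
    after-f (τ , w) with walk-outcome w
    ... | inj₂ o@(rightExit _ _ z z≤0 _ _ _ _) =
      reaches-later w (reaches-now (staircase⇒Rec
        (right-exit-staircase x≤0 0≤y o (proj₁ (proj₁ (leftmost-turned 0≤y o))) ≤-refl
          (λ j x≤j j<z → R-prefix j x≤j (≤-trans (<⇒≤ (<-≤-trans j<z z≤0)) 0≤e))
          (λ j z≤j j<z → contradiction j<z (≤⇒≯ z≤j)))))
    ... | inj₁ o@(leftExit x-shrinks y-same z 0≤z _ swept _) with rightmost-turned x≤0 o
    ...   | (x≤z , z≤y) , lz = reaches-later w (next n y≤e+n)
      where
      e<z : e < z
      e<z = ≰⇒> λ z≤e → R≢L (trans (sym (R-prefix z x≤z z≤e)) lz)

      next : ∀ n → y σ ≤ e + + n → Reaches τ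
      next zero y≤e = contradiction (≤-trans z≤y (subst (y σ ≤_) (+-identityʳ e) y≤e)) (<⇒≱ e<z)
      next (suc m) y≤e+n =
        reaches-from-R-prefix m (≤-trans x-shrinks x≤0) 0≤z (subst (z ≤_) (sym y-same) z≤y) swept
          (subst (_≤ z + + m) (sym y-same)
            (≤-trans (subst (y σ ≤_) (sym (+-assoc e (+ 1) (+ m))) y≤e+n)
                     (+-monoˡ-≤ (+ m) (<⇒+1≤ e<z))))

  reaches-from-LR-suffix : ∀ n {σ b Y} → x σ ≤ b → b ≤ + 0 → + 0 ≤ Y → y σ ≡ Y + + s →
    lab σ ≐ L on[ b , Y ] → lab σ ≐ R on[ Y + + 1 , Y + + s ] → b ≤ x σ + + n → Reaches σ
  reaches-from-LR-suffix n {σ} {b} {Y} x≤b b≤0 0≤Y y≡ L-block R-block b≤x+n =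
    after-f (walk-exists σ x≤0 0≤y)
    where
    x≤0 : x σ ≤ + 0
    x≤0 = ≤-trans x≤b b≤0

    0≤y : + 0 ≤ y σ
    0≤y = subst (+ 0 ≤_) (sym y≡) (≤-trans 0≤Y (i≤i+j Y (+ s)))

    after-f : ∃ (F r s σ) → Reaches σ
    after-f (τ , w) with walk-outcome w
    ... | inj₁ o@(leftExit _ _ z 0≤z _ _ _) with rightmost-turned x≤0 o
    ...   | (_ , z≤y) , lz =
      reaches-later w (reaches-now (staircase⇒Rec
        (left-exit-staircase x≤0 (≤-trans 0≤Y (<⇒≤ (i<i+1 Y))) (trans y≡ (i+j≡i+1+j-1 Y (+ s))) o
          (≤-<-trans z≤Y (i<i+1 Y))
          (λ j z<j j<Y+1 → L-block j (≤-trans b≤0 (≤-trans 0≤z (<⇒≤ z<j))) (<+1⇒≤ j<Y+1))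
          (λ j Y+1≤j j≤y → R-block j Y+1≤j (subst (j ≤_) y≡ j≤y)))))
      where
      z≤Y : z ≤ Y
      z≤Y = ≮⇒≥ λ Y<z → R≢L (trans (sym (R-block z (<⇒+1≤ Y<z) (subst (z ≤_) y≡ z≤y))) lz)
    after-f (τ , w) | inj₂ o@(rightExit x-same y-grows z z≤0 _ swept appended _) with leftmost-turned 0≤y o
    ...   | (x≤z , _) , rz = reaches-later w (next n b≤x+n)
      where
      z<b : z < b
      z<b = ≰⇒> λ b≤z → R≢L (trans (sym rz) (L-block z b≤z (≤-trans z≤0 0≤Y)))

      next : ∀ n → b ≤ x σ + + n → Reaches τ
      next zero b≤x = contradiction (<-≤-trans z<b (subst (b ≤_) (+-identityʳ _) b≤x)) (≤⇒≯ x≤z)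
      next (suc m) b≤x+n =
        reaches-from-LR-suffix m (subst (_≤ z) (sym x-same) x≤z) z≤0 0≤y y-grows swept appended
          (subst (λ u → z ≤ u + + m) (sym x-same) (<+suc⇒≤ {j = x σ} m (<-≤-trans z<b b≤x+n)))

  reaches-Rec : ∀ σ → InΣ σ → Reaches σ
  reaches-Rec σ (x≤0 , 0≤y) with walk-exists σ x≤0 0≤y
  ... | τ , w with walk-outcome w
  ...   | inj₁ o@(leftExit x-shrinks y-same z 0≤z _ swept _) =
    reaches-later w (reaches-from-R-prefix _ (≤-trans x-shrinks x≤0) 0≤z z≤y swept
                       (≤-reflexive (sym (+∣-∣-cancel z≤y))))
    where
    z≤y : z ≤ y τ
    z≤y = subst (z ≤_) (sym y-same) (proj₂ (proj₁ (rightmost-turned x≤0 o)))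
  ...   | inj₂ o@(rightExit x-same y-grows z z≤0 _ swept appended _) =
    reaches-later w (reaches-from-LR-suffix _ x≤z z≤0 0≤y y-grows swept appended
                       (≤-reflexive (sym (+∣-∣-cancel x≤z))))
    where
    x≤z : x τ ≤ z
    x≤z = subst (_≤ z) (sym x-same) (proj₁ (proj₁ (leftmost-turned 0≤y o)))

  Rec-closed : 1 ℕ.≤ s → ∀ σ τ → Rec s σ → F r s σ τ → Rec s τ
  Rec-closed 1≤s σ τ rec w with Rec⇒staircase rec
  ... | a , y₀ , st = from-outcome (walk-outcome w)
    where
    open Staircase st

    0≤y : + 0 ≤ y σ
    0≤y = staircase-0≤y 1≤s st

    from-outcome : LeftExit σ (+ 0) τ ⊎ RightExit σ (+ 0) τ → Rec s τ
    from-outcome (inj₁ o@(leftExit _ _ z _ _ _ _)) with rightmost-turned x≤0 o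
    ... | (x≤z , z≤y) , lz =
      staircase⇒Rec (left-exit-staircase x≤0 0≤y₀ y≡ o z<y₀
                       (λ j z<j j<y₀ → L-block j (≤-trans a≤z (<⇒≤ z<j)) j<y₀) top)
      where
      a≤z : a ≤ z
      a≤z = ≮⇒≥ λ z<a → R≢L (trans (sym (R-block z x≤z z<a)) lz)

      z<y₀ : z < y₀
      z<y₀ = ≰⇒> λ y₀≤z → R≢L (trans (sym (top z y₀≤z z≤y)) lz)
    from-outcome (inj₂ o@(rightExit _ _ z z≤0 _ _ _ _)) with a ≤? z
    ... | yes a≤z =
      staircase⇒Rec (right-exit-staircase x≤0 0≤y o x≤a a≤z R-block
                       (λ j a≤j j<z → L-block j a≤j (<-≤-trans j<z (≤-trans z≤0 0≤y₀))))
    ... | no a≰z =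
      staircase⇒Rec (right-exit-staircase x≤0 0≤y o (proj₁ (proj₁ (leftmost-turned 0≤y o))) ≤-refl
                       (λ j x≤j j<z → R-block j x≤j (<-trans j<z (≰⇒> a≰z)))
                       (λ j z≤j j<z → contradiction j<z (≤⇒≯ z≤j)))

proposition2p4 : (r s : ℕ) → 1 ℕ.≤ r → 1 ℕ.≤ s →
    ((σ τ : State) → Rec s σ → F r s σ τ → Rec s τ) ×
    ((σ : State) → InΣ σ → ∃ λ N → ∃ λ τ → FIter r s N σ τ × Rec s τ)
proposition2p4 r s _ 1≤s = Rec-closed r s 1≤s , reaches-Rec r s
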